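{- For all positive integers $h$, \[ \mathcal{R}_{\mathbb{Z}}(h,3) = \left\{ \binom{h+2}{2} - \binom{t}{2} : t\in[1,h] \right\}. \]
   Context: For real $u,v$, $[u,v]=\{c\in\mathbb{Z}: u\le c\le v\}$. For a nonempty set $A$ of integers and a positive integer $h$, $hA=\{a_1+\cdots+a_h : a_i\in A\}$ (summands not necessarily distinct). $\mathcal{R}_{\mathbb{Z}}(h,k)=\{|hA| : A\subseteq \mathbb{Z},\ |A|=k\}$. Here $\binom{1}{2}=0$. -}

module Defs where

open import Data.Nat using (ℕ; _≤_; _∸_; suc)
open import Data.Nat.Combinatorics using (_C_)
open import Data.Integer using (ℤ; 0ℤ) renaming (_+_ to _+ℤ_)
open import Data.List using (List; length; foldr)
open import Data.List.Membership.Propositional using (_∈_)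
open import Data.List.Relation.Unary.All using (All)
open import Data.List.Relation.Unary.Unique.Propositional using (Unique)
open import Data.Product using (Σ; _×_; ∃)
open import Relation.Binary.PropositionalEquality using (_≡_)
open import Function.Bundles using (_⇔_)

-- Finite sets of integers are represented by duplicate-free lists.

sumℤ : List ℤ → ℤ
sumℤ = foldr _+ℤ_ 0ℤ

_∈Sumset_[_] : ℤ → ℕ → List ℤ → Set
x ∈Sumset h [ A ] = Σ (List ℤ) λ as → length as ≡ h × All (_∈ A) as × sumℤ as ≡ x

HasCard : (ℤ → Set) → ℕ → Set
HasCard P n = Σ (List ℤ) λ L → Unique L × length L ≡ n × (∀ x → (x ∈ L) ⇔ P x)

-- n ∈ R_ℤ(h,k) : n = |hA| for some A ⊆ ℤ with |A| = k.
InRZ : ℕ → ℕ → ℕ → Set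
InRZ h k n = Σ (List ℤ) λ A → Unique A × length A ≡ k × HasCard (λ x → x ∈Sumset h [ A ]) n

choose2 : ℕ → ℕ
choose2 m = m C 2

{-# OPTIONS --safe #-}
-- Sort A as {a, a + B, a + C} with 0 < B < C.  Then hA = h·a + {j B + k C : j + k ≤ h}.  Let
-- γ = lcm(B, C) / B, the least d > 0 with C ∣ d B; B < C forces γ ≥ 2, and γ B = ε C with ε ≤ γ.
-- Replacing (j, k) by (j mod γ, k + ε ⌊j / γ⌋) keeps j + k ≤ h, and a value j B + k C with j < γ
-- determines j and k.  So |hA| is the number of pairs with j < γ and j + k ≤ h, which, column by
-- column, is C(h+2, 2) − C(h+2−γ, 2): take t = h + 2 − γ, or t = 1 when γ > h + 1.  Conversely,
-- A = {0, 1, h + 2 − t} has γ = h + 2 − t.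
module Submission where

open import Defs
open import Data.Nat
  using (ℕ; zero; suc; _+_; _*_; _∸_; _≤_; _<_; z≤n; s≤s; s≤s⁻¹; NonZero; >-nonZero; ≢-nonZero⁻¹)
import Data.Nat.Properties as ℕ
open import Data.Nat.Tactic.RingSolver using (solve-∀)
open import Data.Nat.Combinatorics using (nC1≡n; nCk+nC[k+1]≡[n+1]C[k+1])
open import Data.Nat.Divisibility using (_∣_; divides; ∣⇒≤; ∣-antisym; ∣-refl; 1∣_; n∣m*n; ∣m+n∣m⇒∣n)
open import Data.Nat.DivMod using (_%_; _/_; m%n<n; m≡m%n+[m/n]*n)
open import Data.Nat.GCD using (gcd)
open import Data.Nat.LCM using (lcm; m∣lcm[m,n]; n∣lcm[m,n]; lcm-least; gcd*lcm)
open import Data.Integer using (ℤ; +_; 0ℤ; ∣_∣)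
  renaming (_+_ to _+ᶻ_; _*_ to _*ᶻ_; _-_ to _-ᶻ_; _<_ to _<ᶻ_)
import Data.Integer.Properties as ℤ
import Data.Integer.Tactic.RingSolver as ℤ-Solver
open import Algebra.Properties.AbelianGroup ℤ.+-0-abelianGroup using (∙-cancelˡ)
open import Algebra.Properties.CommutativeSemigroup ℕ.+-commutativeSemigroup using (x∙yz≈y∙xz)
open import Data.List using (List; []; _∷_; _++_; length; map; applyUpTo)
open import Data.List.Properties using (length-++; length-map; length-applyUpTo)
open import Data.List.Membership.Propositional using (_∈_)
open import Data.List.Membership.Propositional.Properties
  using (∈-∃++; ∈-++⁺ˡ; ∈-++⁺ʳ; ∈-++⁻; ∈-applyUpTo⁺; ∈-applyUpTo⁻; ∈-map⁺; ∈-map⁻)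
open import Data.List.Relation.Unary.Any using (here; there)
open import Data.List.Relation.Unary.All as All using (All; []; _∷_)
open import Data.List.Relation.Unary.AllPairs using ([]; _∷_)
open import Data.List.Relation.Unary.Unique.Propositional using (Unique)
import Data.List.Relation.Unary.Unique.Propositional.Properties as Unique
open import Data.List.Relation.Binary.Subset.Propositional using (_⊆_)
open import Data.List.Relation.Binary.Disjoint.Propositional using (Disjoint)
open import Data.List.Relation.Binary.Permutation.Propositional
  using (_↭_; ↭-refl; ↭-prep; ↭-swap; ↭-trans; ↭-sym)
open import Data.List.Relation.Binary.Permutation.Propositional.Properties
  using (∈-resp-↭; ↭-length) renaming (shift to ↭-shift)
open import Data.Product using (Σ; _×_; _,_; ∃; ∃₂; Σ-syntax)
open import Data.Sum using (inj₁; inj₂)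
open import Relation.Nullary using (contradiction; yes; no)
open import Relation.Binary.Definitions using (tri<; tri≈; tri>)
open import Relation.Binary.PropositionalEquality
  using (_≡_; _≢_; refl; sym; trans; cong; subst; module ≡-Reasoning)
open import Function.Bundles using (_⇔_; mk⇔; Equivalence)
open import Function.Properties.Equivalence using () renaming (trans to ⇔-trans)
open import Function.Construct.Identity using (⇔-id)

open Equivalence using (to; from)

Unique⇒length≤ : {A : Set} {xs ys : List A} → Unique xs → xs ⊆ ys → length xs ≤ length ys
Unique⇒length≤ {xs = []}     _              _     = z≤n
Unique⇒length≤ {xs = x ∷ xs} (x∉xs ∷ uniq) xs⊆ys with us , vs , refl ← ∈-∃++ (xs⊆ys (here refl)) =
  begin
    suc (length xs)         ≤⟨ s≤s (Unique⇒length≤ uniq xs⊆us++vs) ⟩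
    suc (length (us ++ vs)) ≡⟨ ↭-length (↭-shift x us vs) ⟨
    length (us ++ x ∷ vs)   ∎
  where
  open ℕ.≤-Reasoning
  skip : ∀ {z} us → z ∈ us ++ x ∷ vs → z ≢ x → z ∈ us ++ vs
  skip []       (here z≡x)   z≢x = contradiction z≡x z≢x
  skip []       (there z∈vs) _   = z∈vs
  skip (_ ∷ us) (here z≡u)   _   = here z≡u
  skip (_ ∷ us) (there z∈)   z≢x = there (skip us z∈ z≢x)
  xs⊆us++vs : xs ⊆ us ++ vs
  xs⊆us++vs z∈xs = skip us (xs⊆ys (there z∈xs)) λ z≡x → All.lookup x∉xs z∈xs (sym z≡x)

HasCard-unique : ∀ {P : ℤ → Set} {m n} → HasCard P m → HasCard P n → m ≡ n
HasCard-unique (L , uL , refl , L⇔P) (M , uM , refl , M⇔P) = ℕ.≤-antisym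
  (Unique⇒length≤ uL λ {x} x∈L → from (M⇔P x) (to (L⇔P x) x∈L))
  (Unique⇒length≤ uM λ {x} x∈M → from (L⇔P x) (to (M⇔P x) x∈M))

HasCard-cong : ∀ {P Q : ℤ → Set} {n} → (∀ x → P x ⇔ Q x) → HasCard P n → HasCard Q n
HasCard-cong P⇔Q (L , u , len , L⇔P) = L , u , len , λ x → ⇔-trans (L⇔P x) (P⇔Q x)

Unique⇒HasCard : ∀ {L : List ℤ} → Unique L → HasCard (_∈ L) (length L)
Unique⇒HasCard {L} u = L , u , refl , λ _ → ⇔-id _

∈Sumset-↭ : ∀ {h A A′ w} → A ↭ A′ → w ∈Sumset h [ A ] ⇔ w ∈Sumset h [ A′ ]
∈Sumset-↭ A↭A′ = mk⇔ (transport A↭A′) (transport (↭-sym A↭A′))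
  where
  transport : ∀ {h A A′ w} → A ↭ A′ → w ∈Sumset h [ A ] → w ∈Sumset h [ A′ ]
  transport A↭A′ (as , len , as⊆A , sum) = as , len , All.map (∈-resp-↭ A↭A′) as⊆A , sum

∈Sumset-cons : ∀ {h A w y} → y ∈ A → w ∈Sumset h [ A ] → (y +ᶻ w) ∈Sumset (suc h) [ A ]
∈Sumset-cons y∈A (as , refl , as⊆A , refl) = _ ∷ as , refl , y∈A ∷ as⊆A , refl

Representable : ℕ → ℕ → ℕ → ℕ → Set
Representable B C h x = ∃₂ λ j k → j + k ≤ h × x ≡ j * B + k * C

module ThreeElementSumset (a : ℤ) (B C : ℕ) where

  A : List ℤ
  A = a ∷ a +ᶻ + B ∷ a +ᶻ + C ∷ []

  shift : ℕ → ℕ → ℤ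
  shift h x = + h *ᶻ a +ᶻ + x

  shift-injective : ∀ h {x y} → shift h x ≡ shift h y → x ≡ y
  shift-injective h eq = ℤ.+-injective (∙-cancelˡ (+ h *ᶻ a) _ _ eq)

  shift-zero : 0ℤ ≡ shift 0 0
  shift-zero = sym (trans (ℤ.+-identityʳ _) (ℤ.*-zeroˡ a))

  shift-step : ∀ d h x → (a +ᶻ + d) +ᶻ shift h x ≡ shift (suc h) (d + x)
  shift-step d h x = identity a (+ d) (+ h) (+ x)
    where
    identity : ∀ a d h x → (a +ᶻ d) +ᶻ (h *ᶻ a +ᶻ x) ≡ (+ 1 +ᶻ h) *ᶻ a +ᶻ (d +ᶻ x)
    identity = ℤ-Solver.solve-∀

  shift-step₀ : ∀ h x → a +ᶻ shift h x ≡ shift (suc h) x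
  shift-step₀ h x = trans (cong (_+ᶻ shift h x) (sym (ℤ.+-identityʳ a))) (shift-step 0 h x)

  sum-shift : ∀ as → All (_∈ A) as →
              ∃ λ x → Representable B C (length as) x × sumℤ as ≡ shift (length as) x
  sum-shift [] [] = 0 , (0 , 0 , z≤n , refl) , shift-zero
  sum-shift (w ∷ as) (w∈A ∷ as⊆A) with sum-shift as as⊆A
  ... | x , (j , k , j+k≤n , refl) , sum≡ with w∈A
  ...   | here refl = x , (j , k , ℕ.m≤n⇒m≤1+n j+k≤n , refl) ,
            trans (cong (a +ᶻ_) sum≡) (shift-step₀ (length as) x)
  ...   | there (here refl) = B + x , (suc j , k , s≤s j+k≤n , sym (ℕ.+-assoc B (j * B) (k * C))) ,
            trans (cong (w +ᶻ_) sum≡) (shift-step B (length as) x)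
  ...   | there (there (here refl)) =
            C + x , (j , suc k , subst (_≤ suc (length as)) (sym (ℕ.+-suc j k)) (s≤s j+k≤n) ,
                     x∙yz≈y∙xz C (j * B) (k * C)) ,
            trans (cong (w +ᶻ_) sum≡) (shift-step C (length as) x)

  shift-∈Sumset-counts : ∀ i j k → shift (i + j + k) (j * B + k * C) ∈Sumset (i + j + k) [ A ]
  shift-∈Sumset-counts zero zero zero = [] , refl , [] , shift-zero
  shift-∈Sumset-counts (suc i) j k =
    subst (_∈Sumset _ [ A ]) (shift-step₀ (i + j + k) (j * B + k * C))
          (∈Sumset-cons (here refl) (shift-∈Sumset-counts i j k))
  shift-∈Sumset-counts zero (suc j) k =
    subst (_∈Sumset _ [ A ])
          (trans (shift-step B (j + k) (j * B + k * C))
                 (cong (shift (suc (j + k))) (sym (ℕ.+-assoc B (j * B) (k * C)))))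
          (∈Sumset-cons (there (here refl)) (shift-∈Sumset-counts zero j k))
  shift-∈Sumset-counts zero zero (suc k) =
    subst (_∈Sumset _ [ A ]) (shift-step C k (k * C))
          (∈Sumset-cons (there (there (here refl))) (shift-∈Sumset-counts zero zero k))

  shift-∈Sumset : ∀ {h x} → Representable B C h x → shift h x ∈Sumset h [ A ]
  shift-∈Sumset {h} (j , k , j+k≤h , refl) =
    subst (λ n → shift n (j * B + k * C) ∈Sumset n [ A ]) i+j+k≡h
          (shift-∈Sumset-counts (h ∸ (j + k)) j k)
    where
    i+j+k≡h : h ∸ (j + k) + j + k ≡ h
    i+j+k≡h = trans (ℕ.+-assoc (h ∸ (j + k)) j k) (ℕ.m∸n+n≡m j+k≤h)

  ∈Sumset⇔ : ∀ h w → w ∈Sumset h [ A ] ⇔ ∃ λ x → Representable B C h x × w ≡ shift h x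
  ∈Sumset⇔ h w = mk⇔ sum-of-sumset shift-of-representable
    where
    sum-of-sumset : w ∈Sumset h [ A ] → ∃ λ x → Representable B C h x × w ≡ shift h x
    sum-of-sumset (as , refl , as⊆A , refl) = sum-shift as as⊆A
    shift-of-representable : (∃ λ x → Representable B C h x × w ≡ shift h x) → w ∈Sumset h [ A ]
    shift-of-representable (x , rep , refl) = shift-∈Sumset rep

choose2-suc : ∀ n → choose2 (suc n) ≡ n + choose2 n
choose2-suc n = sym (trans (cong (_+ choose2 n) (sym (nC1≡n n))) (nCk+nC[k+1]≡[n+1]C[k+1] n 1))

choose2-suc-∸ : ∀ n m → choose2 (suc n ∸ m) ≡ (n ∸ m) + choose2 (n ∸ m)
choose2-suc-∸ n       zero    = choose2-suc n
choose2-suc-∸ zero    (suc m) rewrite ℕ.0∸n≡0 m = refl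
choose2-suc-∸ (suc n) (suc m) = choose2-suc-∸ n m

k<1+h∸j⇒j+k≤h : ∀ h j {k} → k < suc h ∸ j → j + k ≤ h
k<1+h∸j⇒j+k≤h h       zero    k<1+h = s≤s⁻¹ k<1+h
k<1+h∸j⇒j+k≤h zero    (suc j) {k} k<0∸j = contradiction (subst (k <_) (ℕ.0∸n≡0 j) k<0∸j) λ ()
k<1+h∸j⇒j+k≤h (suc h) (suc j) k<1+h∸j = s≤s (k<1+h∸j⇒j+k≤h h j k<1+h∸j)

j+k≤h⇒k<1+h∸j : ∀ h j {k} → j + k ≤ h → k < suc h ∸ j
j+k≤h⇒k<1+h∸j h       zero    k≤h     = s≤s k≤h
j+k≤h⇒k<1+h∸j (suc h) (suc j) j+k≤h = j+k≤h⇒k<1+h∸j h j (s≤s⁻¹ j+k≤h)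

IncongruentMultiples : ℕ → ℕ → ℕ → Set
IncongruentMultiples B C m = ∀ {j j′} k k′ → j < m → j′ < m → j * B + k * C ≡ j′ * B + k′ * C → j ≡ j′

module Columns (B C h : ℕ) where

  column : ℕ → List ℕ
  column j = applyUpTo (λ k → j * B + k * C) (suc h ∸ j)

  columns : ℕ → List ℕ
  columns zero    = []
  columns (suc m) = columns m ++ column m

  ∈-column⇔ : ∀ j {x} → x ∈ column j ⇔ ∃ λ k → j + k ≤ h × x ≡ j * B + k * C
  ∈-column⇔ j = mk⇔ below above
    where
    below : ∀ {x} → x ∈ column j → ∃ λ k → j + k ≤ h × x ≡ j * B + k * C
    below x∈ with k , k< , refl ← ∈-applyUpTo⁻ _ x∈ = k , k<1+h∸j⇒j+k≤h h j k< , refl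
    above : ∀ {x} → (∃ λ k → j + k ≤ h × x ≡ j * B + k * C) → x ∈ column j
    above (k , j+k≤h , refl) = ∈-applyUpTo⁺ _ (j+k≤h⇒k<1+h∸j h j j+k≤h)

  ∈-columns⇔ : ∀ m {x} → x ∈ columns m ⇔ ∃₂ λ j k → j < m × j + k ≤ h × x ≡ j * B + k * C
  ∈-columns⇔ m = mk⇔ (below m) (above m)
    where
    below : ∀ m {x} → x ∈ columns m → ∃₂ λ j k → j < m × j + k ≤ h × x ≡ j * B + k * C
    below (suc m) x∈ with ∈-++⁻ (columns m) x∈
    ... | inj₁ x∈cols with j , k , j<m , rest ← below m x∈cols = j , k , ℕ.m<n⇒m<1+n j<m , rest
    ... | inj₂ x∈col  with k , rest ← to (∈-column⇔ m) x∈col = m , k , ℕ.n<1+n m , rest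
    above : ∀ m {x} → (∃₂ λ j k → j < m × j + k ≤ h × x ≡ j * B + k * C) → x ∈ columns m
    above (suc m) (j , k , j<1+m , rest) with ℕ.m<1+n⇒m<n∨m≡n j<1+m
    ... | inj₁ j<m  = ∈-++⁺ˡ (above m (j , k , j<m , rest))
    ... | inj₂ refl = ∈-++⁺ʳ (columns m) (from (∈-column⇔ m) (k , rest))

  length-columns : ∀ m → length (columns m) + choose2 (suc (suc h) ∸ m) ≡ choose2 (suc (suc h))
  length-columns zero    = refl
  length-columns (suc m) = begin
    length (columns m ++ column m) + choose2 (suc h ∸ m)
      ≡⟨ cong (_+ choose2 (suc h ∸ m)) (trans (length-++ (columns m))
                                               (cong (λ n → length (columns m) + n) (length-applyUpTo _ (suc h ∸ m)))) ⟩
    length (columns m) + (suc h ∸ m) + choose2 (suc h ∸ m)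
      ≡⟨ ℕ.+-assoc (length (columns m)) _ _ ⟩
    length (columns m) + ((suc h ∸ m) + choose2 (suc h ∸ m))
      ≡⟨ cong (λ n → length (columns m) + n) (choose2-suc-∸ (suc h) m) ⟨
    length (columns m) + choose2 (suc (suc h) ∸ m)
      ≡⟨ length-columns m ⟩
    choose2 (suc (suc h)) ∎
    where open ≡-Reasoning

  column-unique : 0 < C → ∀ j → Unique (column j)
  column-unique C>0 j = Unique.applyUpTo⁺₁ _ _ λ {k} {k′} k<k′ _ eq →
    ℕ.<⇒≢ k<k′ (ℕ.*-cancelʳ-≡ k k′ C {{>-nonZero C>0}} (ℕ.+-cancelˡ-≡ (j * B) _ _ eq))

  columns-unique : 0 < C → ∀ m → IncongruentMultiples B C m → Unique (columns m)
  columns-unique C>0 zero    _        = []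
  columns-unique C>0 (suc m) distinct =
    Unique.++⁺ (columns-unique C>0 m distinct′) (column-unique C>0 m) disjoint
    where
    distinct′ : IncongruentMultiples B C m
    distinct′ k k′ j<m j′<m = distinct k k′ (ℕ.m<n⇒m<1+n j<m) (ℕ.m<n⇒m<1+n j′<m)
    disjoint : Disjoint (columns m) (column m)
    disjoint (x∈cols , x∈col) with j , k , j<m , _ , refl ← to (∈-columns⇔ m) x∈cols
                                  | k′ , _ , eq ← to (∈-column⇔ m) x∈col =
      ℕ.<⇒≢ j<m (distinct k k′ (ℕ.m<n⇒m<1+n j<m) (ℕ.n<1+n m) eq)

-- lcm B C / B, the additive order of B modulo C
period : ℕ → ℕ → ℕ
period B C = _∣_.quotient (m∣lcm[m,n] B C)

lcm≡period*B : ∀ B C → lcm B C ≡ period B C * B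
lcm≡period*B B C = _∣_.equality (m∣lcm[m,n] B C)

period-minimal : ∀ {B C d} → 0 < B → 0 < d → C ∣ d * B → period B C ≤ d
period-minimal {B} {C} {d} B>0 d>0 C∣dB = ℕ.*-cancelʳ-≤ (period B C) d B {{>-nonZero B>0}}
  (subst (_≤ d * B) (lcm≡period*B B C)
         (∣⇒≤ {{ℕ.m*n≢0 d B {{>-nonZero d>0}} {{>-nonZero B>0}}}} (lcm-least (n∣m*n d) C∣dB)))

C∣d*B⇒d≡0 : ∀ {B C d} → 0 < B → d < period B C → C ∣ d * B → d ≡ 0
C∣d*B⇒d≡0 {d = zero}  _   _    _    = refl
C∣d*B⇒d≡0 {d = suc d} B>0 d<γ C∣dB = contradiction (period-minimal B>0 (s≤s z≤n) C∣dB) (ℕ.<⇒≱ d<γ)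

period-positive : ∀ {B C} → 0 < B → 0 < C → 0 < period B C
period-positive {B} {C} B>0 C>0 = ℕ.n≢0⇒n>0 λ γ≡0 →
  ≢-nonZero⁻¹ (B * C) {{ℕ.m*n≢0 B C {{>-nonZero B>0}} {{>-nonZero C>0}}}} (begin
    B * C             ≡⟨ gcd*lcm B C ⟨
    gcd B C * lcm B C ≡⟨ cong (gcd B C *_) (trans (lcm≡period*B B C) (cong (_* B) γ≡0)) ⟩
    gcd B C * 0       ≡⟨ ℕ.*-zeroʳ (gcd B C) ⟩
    0                 ∎)
  where open ≡-Reasoning

period≥2 : ∀ {B C} → 0 < B → B < C → 2 ≤ period B C
period≥2 {B} {C} B>0 B<C with period B C | lcm≡period*B B C | period-positive B>0 (ℕ.<-trans B>0 B<C)
... | suc zero    | lcm≡1*B | _ = contradiction (∣⇒≤ {{>-nonZero B>0}} C∣B) (ℕ.<⇒≱ B<C)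
  where
  C∣B : C ∣ B
  C∣B = subst (C ∣_) (trans lcm≡1*B (ℕ.*-identityˡ B)) (n∣lcm[m,n] B C)
... | suc (suc _) | _       | _ = s≤s (s≤s z≤n)

period*B≡ε*C : ∀ {B C} → 0 < C → B ≤ C → ∃ λ ε → ε ≤ period B C × period B C * B ≡ ε * C
period*B≡ε*C {B} {C} C>0 B≤C with divides ε lcm≡ε*C ← n∣lcm[m,n] B C =
  ε , ℕ.*-cancelʳ-≤ ε (period B C) C {{>-nonZero C>0}} ε*C≤γ*C , γ*B≡ε*C
  where
  γ*B≡ε*C : period B C * B ≡ ε * C
  γ*B≡ε*C = trans (sym (lcm≡period*B B C)) lcm≡ε*C
  ε*C≤γ*C : ε * C ≤ period B C * C
  ε*C≤γ*C = subst (_≤ period B C * C) γ*B≡ε*C (ℕ.*-monoʳ-≤ (period B C) B≤C)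

C∣gap*B : ∀ {B C j j′} k k′ → j ≤ j′ → j * B + k * C ≡ j′ * B + k′ * C → C ∣ (j′ ∸ j) * B
C∣gap*B {B} {C} {j} {j′} k k′ j≤j′ eq = ∣m+n∣m⇒∣n (subst (C ∣_) k*C≡ (n∣m*n k)) (n∣m*n k′)
  where
  open ≡-Reasoning
  rearrange : ∀ j d b k c → (j + d) * b + k * c ≡ j * b + (k * c + d * b)
  rearrange = solve-∀
  k*C≡ : k * C ≡ k′ * C + (j′ ∸ j) * B
  k*C≡ = ℕ.+-cancelˡ-≡ (j * B) _ _ (begin
    j * B + k * C                ≡⟨ eq ⟩
    j′ * B + k′ * C              ≡⟨ cong (λ i → i * B + k′ * C) (ℕ.m+[n∸m]≡n j≤j′) ⟨
    (j + (j′ ∸ j)) * B + k′ * C  ≡⟨ rearrange j (j′ ∸ j) B k′ C ⟩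
    j * B + (k′ * C + (j′ ∸ j) * B) ∎)

period-incongruent-≤ : ∀ {B C j j′} k k′ → 0 < B → j ≤ j′ → j′ < period B C →
                       j * B + k * C ≡ j′ * B + k′ * C → j ≡ j′
period-incongruent-≤ {j = j} {j′} k k′ B>0 j≤j′ j′<γ eq = ℕ.≤-antisym j≤j′ (ℕ.m∸n≡0⇒m≤n j′∸j≡0)
  where
  j′∸j≡0 : j′ ∸ j ≡ 0
  j′∸j≡0 = C∣d*B⇒d≡0 B>0 (ℕ.≤-<-trans (ℕ.m∸n≤m j′ j) j′<γ) (C∣gap*B k k′ j≤j′ eq)

period-incongruent : ∀ {B C} → 0 < B → IncongruentMultiples B C (period B C)
period-incongruent B>0 {j} {j′} k k′ j<γ j′<γ eq with ℕ.≤-total j j′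
... | inj₁ j≤j′ = period-incongruent-≤ k k′ B>0 j≤j′ j′<γ eq
... | inj₂ j′≤j = sym (period-incongruent-≤ k′ k B>0 j′≤j j<γ (sym eq))

period[1,n]≡n : ∀ n → period 1 n ≡ n
period[1,n]≡n n = trans (sym (ℕ.*-identityʳ (period 1 n))) (trans (sym (lcm≡period*B 1 n)) lcm[1,n]≡n)
  where
  lcm[1,n]≡n : lcm 1 n ≡ n
  lcm[1,n]≡n = ∣-antisym (lcm-least (1∣ n) ∣-refl) (n∣lcm[m,n] 1 n)

reduce-mod-period : ∀ {B C γ ε h x} .{{_ : NonZero γ}} → ε ≤ γ → γ * B ≡ ε * C →
  Representable B C h x → ∃₂ λ j k → j < γ × j + k ≤ h × x ≡ j * B + k * C
reduce-mod-period {B} {C} {γ} {ε} {h} ε≤γ γ*B≡ε*C (j , k , j+k≤h , refl) =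
  j % γ , j / γ * ε + k , m%n<n j γ , bound , value
  where
  bound : j % γ + (j / γ * ε + k) ≤ h
  bound = begin
    j % γ + (j / γ * ε + k)   ≤⟨ ℕ.+-monoʳ-≤ (j % γ) (ℕ.+-monoˡ-≤ k (ℕ.*-monoʳ-≤ (j / γ) ε≤γ)) ⟩
    j % γ + (j / γ * γ + k)   ≡⟨ ℕ.+-assoc (j % γ) _ k ⟨
    j % γ + j / γ * γ + k     ≡⟨ cong (_+ k) (m≡m%n+[m/n]*n j γ) ⟨
    j + k                     ≤⟨ j+k≤h ⟩
    h                         ∎
    where open ℕ.≤-Reasoning
  expand : ∀ r q g b k c → (r + q * g) * b + k * c ≡ r * b + q * (g * b) + k * c
  expand = solve-∀
  collect : ∀ r q e c b k → r * b + q * (e * c) + k * c ≡ r * b + (q * e + k) * c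
  collect = solve-∀
  value : j * B + k * C ≡ j % γ * B + (j / γ * ε + k) * C
  value = begin
    j * B + k * C                                ≡⟨ cong (λ i → i * B + k * C) (m≡m%n+[m/n]*n j γ) ⟩
    (j % γ + j / γ * γ) * B + k * C              ≡⟨ expand (j % γ) (j / γ) γ B k C ⟩
    j % γ * B + j / γ * (γ * B) + k * C          ≡⟨ cong (λ u → j % γ * B + j / γ * u + k * C) γ*B≡ε*C ⟩
    j % γ * B + j / γ * (ε * C) + k * C          ≡⟨ collect (j % γ) (j / γ) ε C B k ⟩
    j % γ * B + (j / γ * ε + k) * C              ∎
    where open ≡-Reasoning

∈columns[period]⇔Representable : ∀ {B C h x} → 0 < B → B ≤ C →
  x ∈ Columns.columns B C h (period B C) ⇔ Representable B C h x
∈columns[period]⇔Representable {B} {C} {h} B>0 B≤C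
  with ε , ε≤γ , γ*B≡ε*C ← period*B≡ε*C (ℕ.<-≤-trans B>0 B≤C) B≤C = mk⇔ forget reduce
  where
  open Columns B C h
  instance
    γ≢0 : NonZero (period B C)
    γ≢0 = >-nonZero (period-positive B>0 (ℕ.<-≤-trans B>0 B≤C))
  forget : ∀ {x} → x ∈ columns (period B C) → Representable B C h x
  forget x∈ with j , k , _ , rep ← to (∈-columns⇔ (period B C)) x∈ = j , k , rep
  reduce : ∀ {x} → Representable B C h x → x ∈ columns (period B C)
  reduce rep = from (∈-columns⇔ (period B C)) (reduce-mod-period ε≤γ γ*B≡ε*C rep)

card-sumset-three : ∀ h a {B C} → 0 < B → B ≤ C →
  HasCard (_∈Sumset h [ a ∷ a +ᶻ + B ∷ a +ᶻ + C ∷ [] ]) (choose2 (2 + h) ∸ choose2 (2 + h ∸ period B C))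
card-sumset-three h a {B} {C} B>0 B≤C =
  subst (HasCard _) size (HasCard-cong (λ w → mk⇔ (point⇒sum w) (sum⇒point w)) (Unique⇒HasCard unique))
  where
  open ThreeElementSumset a B C
  open Columns B C h
  points : List ℤ
  points = map (shift h) (columns (period B C))
  unique : Unique points
  unique = Unique.map⁺ (shift-injective h)
             (columns-unique (ℕ.<-≤-trans B>0 B≤C) (period B C) (period-incongruent B>0))
  point⇒sum : ∀ w → w ∈ points → w ∈Sumset h [ A ]
  point⇒sum w w∈ with x , x∈ , refl ← ∈-map⁻ (shift h) w∈ =
    from (∈Sumset⇔ h w) (x , to (∈columns[period]⇔Representable B>0 B≤C) x∈ , refl)
  sum⇒point : ∀ w → w ∈Sumset h [ A ] → w ∈ points
  sum⇒point w w∈hA with x , rep , refl ← to (∈Sumset⇔ h w) w∈hA =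
    ∈-map⁺ (shift h) (from (∈columns[period]⇔Representable B>0 B≤C) rep)
  size : length points ≡ choose2 (2 + h) ∸ choose2 (2 + h ∸ period B C)
  size = trans (length-map (shift h) (columns (period B C)))
               (trans (sym (ℕ.m+n∸n≡m _ (choose2 (2 + h ∸ period B C))))
                      (cong (_∸ choose2 (2 + h ∸ period B C)) (length-columns (period B C))))

sort-three : ∀ {x y z : ℤ} → x ≢ y → x ≢ z → y ≢ z →
  Σ[ a ∈ ℤ ] Σ[ b ∈ ℤ ] Σ[ c ∈ ℤ ] a <ᶻ b × b <ᶻ c × x ∷ y ∷ z ∷ [] ↭ a ∷ b ∷ c ∷ []
sort-three {x} {y} {z} x≢y x≢z y≢z with ℤ.<-cmp x y | ℤ.<-cmp y z | ℤ.<-cmp x z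
... | tri≈ _ x≡y _ | _            | _            = contradiction x≡y x≢y
... | _            | tri≈ _ y≡z _ | _            = contradiction y≡z y≢z
... | _            | _            | tri≈ _ x≡z _ = contradiction x≡z x≢z
... | tri< x<y _ _ | tri< y<z _ _ | _            = x , y , z , x<y , y<z , ↭-refl
... | tri< x<y _ _ | tri> _ _ z<y | tri< x<z _ _ = x , z , y , x<z , z<y ,
  ↭-prep x (↭-swap y z ↭-refl)
... | tri< x<y _ _ | tri> _ _ z<y | tri> _ _ z<x = z , x , y , z<x , x<y ,
  ↭-trans (↭-prep x (↭-swap y z ↭-refl)) (↭-swap x z ↭-refl)
... | tri> _ _ y<x | tri< y<z _ _ | tri< x<z _ _ = y , x , z , y<x , x<z ,
  ↭-swap x y ↭-refl
... | tri> _ _ y<x | tri< y<z _ _ | tri> _ _ z<x = y , z , x , y<z , z<x ,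
  ↭-trans (↭-swap x y ↭-refl) (↭-prep y (↭-swap x z ↭-refl))
... | tri> _ _ y<x | tri> _ _ z<y | _            = z , y , x , z<y , y<x ,
  ↭-trans (↭-swap x y ↭-refl) (↭-trans (↭-prep y (↭-swap x z ↭-refl)) (↭-swap y z ↭-refl))

<⇒≡+1+ : ∀ {i j} → i <ᶻ j → ∃ λ d → j ≡ i +ᶻ + suc d
<⇒≡+1+ {i} {j} i<j with ∣ i -ᶻ j ∣ | ℤ.∣-∣-≤ (ℤ.<⇒≤ i<j)
... | zero  | 0≡j-i   = contradiction (sym (ℤ.i-j≡0⇒i≡j j i (sym 0≡j-i))) (ℤ.<⇒≢ i<j)
... | suc d | 1+d≡j-i = d , trans (sym (i+[j-i]≡j i j)) (cong (i +ᶻ_) (sym 1+d≡j-i))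
  where
  i+[j-i]≡j : ∀ i j → i +ᶻ (j -ᶻ i) ≡ j
  i+[j-i]≡j = ℤ-Solver.solve-∀

sort-as-offsets : ∀ {x y z : ℤ} → Unique (x ∷ y ∷ z ∷ []) →
  Σ[ a ∈ ℤ ] Σ[ B ∈ ℕ ] Σ[ C ∈ ℕ ] 0 < B × B < C × x ∷ y ∷ z ∷ [] ↭ a ∷ a +ᶻ + B ∷ a +ᶻ + C ∷ []
sort-as-offsets ((x≢y ∷ x≢z ∷ []) ∷ (y≢z ∷ []) ∷ [] ∷ [])
  with a , b , c , a<b , b<c , π ← sort-three x≢y x≢z y≢z
  with d₁ , refl ← <⇒≡+1+ a<b
  with d₂ , refl ← <⇒≡+1+ b<c =
  a , suc d₁ , suc d₁ + suc d₂ , s≤s z≤n , ℕ.m<m+n (suc d₁) (s≤s z≤n) ,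
  subst (λ c → _ ↭ a ∷ a +ᶻ + suc d₁ ∷ c ∷ []) (ℤ.+-assoc a (+ suc d₁) (+ suc d₂)) π

offsets-unique : ∀ a {B C} → 0 < B → B < C → Unique (a ∷ a +ᶻ + B ∷ a +ᶻ + C ∷ [])
offsets-unique a B>0 B<C =
  (a≢a+ B>0 ∷ a≢a+ (ℕ.<-trans B>0 B<C) ∷ []) ∷ (a+≢a+ B<C ∷ []) ∷ [] ∷ []
  where
  a+≢a+ : ∀ {m n} → m < n → a +ᶻ + m ≢ a +ᶻ + n
  a+≢a+ m<n eq = ℕ.<⇒≢ m<n (ℤ.+-injective (∙-cancelˡ a _ _ eq))
  a≢a+ : ∀ {n} → 0 < n → a ≢ a +ᶻ + n
  a≢a+ n>0 eq = a+≢a+ n>0 (trans (ℤ.+-identityʳ a) eq)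

-- If γ > h + 1, then 2 + h ∸ γ truncates to 0 and choose2 0 = choose2 1 = 0.
choose2[2+h∸γ]≡choose2[t] : ∀ {h γ} → 1 ≤ h → 2 ≤ γ → ∃ λ t → (1 ≤ t × t ≤ h) × choose2 (2 + h ∸ γ) ≡ choose2 t
choose2[2+h∸γ]≡choose2[t] {h} {γ} h≥1 γ≥2 with γ ℕ.≤? suc h
... | yes γ≤1+h = 2 + h ∸ γ , (ℕ.m<n⇒0<n∸m (s≤s γ≤1+h) , ℕ.∸-monoʳ-≤ (2 + h) γ≥2) , refl
... | no  γ≰1+h = 1 , (ℕ.≤-refl , h≥1) , cong choose2 (ℕ.m≤n⇒m∸n≡0 (ℕ.≰⇒> γ≰1+h))

InRZ-three⇒ : ∀ {h n} → 1 ≤ h → InRZ h 3 n → ∃ λ t → (1 ≤ t × t ≤ h) × n ≡ choose2 (2 + h) ∸ choose2 t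
InRZ-three⇒ {h} {n} h≥1 (_ ∷ _ ∷ _ ∷ [] , distinct , refl , card)
  with a , B , C , B>0 , B<C , π ← sort-as-offsets distinct
  with t , t∈[1,h] , choose2≡ ← choose2[2+h∸γ]≡choose2[t] h≥1 (period≥2 B>0 B<C) =
  t , t∈[1,h] , trans n≡ (cong (choose2 (2 + h) ∸_) choose2≡)
  where
  n≡ : n ≡ choose2 (2 + h) ∸ choose2 (2 + h ∸ period B C)
  n≡ = HasCard-unique (HasCard-cong (λ _ → ∈Sumset-↭ π) card) (card-sumset-three h a B>0 (ℕ.<⇒≤ B<C))

⇒InRZ-three : ∀ {h t} → t ≤ h → InRZ h 3 (choose2 (2 + h) ∸ choose2 t)
⇒InRZ-three {h} {t} t≤h =
  0ℤ ∷ 0ℤ +ᶻ + 1 ∷ 0ℤ +ᶻ + γ ∷ [] , offsets-unique 0ℤ (s≤s z≤n) 1<γ , refl ,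
  subst (HasCard _) size (card-sumset-three h 0ℤ (s≤s z≤n) (ℕ.<⇒≤ 1<γ))
  where
  γ : ℕ
  γ = 2 + h ∸ t
  1<γ : 1 < γ
  1<γ = subst (_≤ γ) (ℕ.m+n∸n≡m 2 h) (ℕ.∸-monoʳ-≤ (2 + h) t≤h)
  size : choose2 (2 + h) ∸ choose2 (2 + h ∸ period 1 γ) ≡ choose2 (2 + h) ∸ choose2 t
  size = cong (λ p → choose2 (2 + h) ∸ choose2 p)
              (trans (cong (2 + h ∸_) (period[1,n]≡n γ)) (ℕ.m∸[m∸n]≡n (ℕ.m≤n⇒m≤o+n 2 t≤h)))

theorem9 : (h : ℕ) → 1 ≤ h → (n : ℕ) →
    InRZ h 3 n ⇔ (Σ ℕ λ t → (1 ≤ t × t ≤ h) × n ≡ choose2 (h + 2) ∸ choose2 t)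
theorem9 h h≥1 n rewrite ℕ.+-comm h 2 = mk⇔ (InRZ-three⇒ h≥1) witness
  where
  witness : (Σ ℕ λ t → (1 ≤ t × t ≤ h) × n ≡ choose2 (2 + h) ∸ choose2 t) → InRZ h 3 n
  witness (t , (_ , t≤h) , refl) = ⇒InRZ-three t≤h
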